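{- Let $\mathbf{L}=\langle L,\leq\rangle$ be a complete lattice, $S$ an $L$-parameterization, and $C\colon L\to L$ a closure operator in $\mathbf{L}$. The following are equivalent: (1) $C$ is an $S$-closure operator in $\mathbf{L}$; (2) $f(C(a))\leq C(f(a))$ for all $a\in L$ and all $\langle f,h\rangle\in S$; (3) $C(h(a))\leq h(C(a))$ for all $a\in L$ and all $\langle f,h\rangle\in S$.
   Context: A closure operator in $\mathbf{L}$ is $C\colon L\to L$ that is extensive ($a\leq C(a)$), monotone ($a\leq b$ implies $C(a)\leq C(b)$) and idempotent ($C(C(a))=C(a)$). An isotone Galois connection in $\mathbf{L}$ is a pair $\langle f,h\rangle$ of maps $L\to L$ with $f(a)\leq b$ iff $a\leq h(b)$. An $L$-parameterization is a set $S$ of isotone Galois connections containing $\langle\mathrm{id},\mathrm{id}\rangle$. An $S$-closure operator is $C\colon L\to L$ with $a\leq C(a)$, $a\leq b$ implies $C(a)\leq C(b)$, and $C(h(C(a)))\leq h(C(a))$ for all $a,b\in L$ and $\langle f,h\rangle\in S$. -}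

module Defs where

open import Level using (Level; _⊔_; suc)
open import Data.Product using (_×_; Σ)
open import Function using (id; _∘_)
open import Relation.Binary.Bundles using (Poset)
open import Relation.Binary.Lattice.Definitions using (Supremum)

record IsCompleteLattice {c ℓ₁ ℓ₂ : Level} (ℓs : Level) (P : Poset c ℓ₁ ℓ₂)
       : Set (c ⊔ ℓ₁ ⊔ ℓ₂ ⊔ suc ℓs) where
  open Poset P
  field
    ⋁        : (Carrier → Set ℓs) → Carrier
    ⋁-upper  : ∀ (X : Carrier → Set ℓs) x → X x → x ≤ ⋁ X
    ⋁-least  : ∀ (X : Carrier → Set ℓs) u → (∀ x → X x → x ≤ u) → ⋁ X ≤ u

module _ {c ℓ₁ ℓ₂ : Level} (P : Poset c ℓ₁ ℓ₂) where
  open Poset P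

  Op : Set c
  Op = Carrier → Carrier

  record IsClosureOperator (C : Op) : Set (c ⊔ ℓ₁ ⊔ ℓ₂) where
    field
      extensive  : ∀ a → a ≤ C a
      monotone   : ∀ a b → a ≤ b → C a ≤ C b
      idempotent : ∀ a → C (C a) ≈ C a

  record IsIsotoneGaloisConnection (f h : Op) : Set (c ⊔ ℓ₂) where
    field
      to   : ∀ a b → f a ≤ b → a ≤ h b
      from : ∀ a b → a ≤ h b → f a ≤ b

  record IsParameterization {ℓS : Level} (S : Op → Op → Set ℓS)
         : Set (c ⊔ ℓ₂ ⊔ ℓS) where
    field
      galois : ∀ f h → S f h → IsIsotoneGaloisConnection f h
      has-id : S id id

  record IsSClosureOperator {ℓS : Level} (S : Op → Op → Set ℓS) (C : Op)
         : Set (c ⊔ ℓ₂ ⊔ ℓS) where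
    field
      extensive : ∀ a → a ≤ C a
      monotone  : ∀ a b → a ≤ b → C a ≤ C b
      S-closed  : ∀ a f h → S f h → C (h (C a)) ≤ h (C a)

-- For a single isotone Galois connection ⟨f,h⟩ and a monotone C, the inequalities
-- f ∘ C ≤ C ∘ f and C ∘ h ≤ h ∘ C are adjoint forms of each other, obtained by
-- composing with the unit a ≤ h (f a) or the counit f (h a) ≤ a. For a closure
-- operator, C ∘ h ≤ h ∘ C applied at C a says that h (C a) is C-closed; conversely,
-- h being monotone, C (h a) ≤ C (h (C a)) ≤ h (C a).
module Submission where

open import Defs
open import Level using (Level)
open import Data.Product using (_×_; _,_)
open import Function.Bundles using (_⇔_; mk⇔)
open import Function.Construct.Composition using (_⇔-∘_)
open import Relation.Binary.Bundles using (Poset)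

module GaloisClosure {c ℓ₁ ℓ₂ : Level} (P : Poset c ℓ₁ ℓ₂) where
  open Poset P

  module _ {f h : Op P} (g : IsIsotoneGaloisConnection P f h) where
    open IsIsotoneGaloisConnection g

    unit : ∀ a → a ≤ h (f a)
    unit a = to a (f a) refl

    counit : ∀ a → f (h a) ≤ a
    counit a = from (h a) a refl

    h-monotone : ∀ a b → a ≤ b → h a ≤ h b
    h-monotone a b a≤b = to (h a) b (trans (counit a) a≤b)

    module _ {C : Op P} (C-monotone : ∀ a b → a ≤ b → C a ≤ C b) where

      C∘h≤h∘C⇒f∘C≤C∘f : (∀ a → C (h a) ≤ h (C a)) → ∀ a → f (C a) ≤ C (f a)
      C∘h≤h∘C⇒f∘C≤C∘f C∘h≤h∘C a =
        from (C a) (C (f a)) (trans (C-monotone _ _ (unit a)) (C∘h≤h∘C (f a)))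

      f∘C≤C∘f⇒C∘h≤h∘C : (∀ a → f (C a) ≤ C (f a)) → ∀ a → C (h a) ≤ h (C a)
      f∘C≤C∘f⇒C∘h≤h∘C f∘C≤C∘f a =
        to (C (h a)) (C a) (trans (f∘C≤C∘f (h a)) (C-monotone _ _ (counit a)))

  module Closure {ℓS : Level} {S : Op P → Op P → Set ℓS} (par : IsParameterization P S)
           {C : Op P} (cl : IsClosureOperator P C) where
    open IsParameterization par
    open IsClosureOperator cl

    S-closure⇒C∘h≤h∘C : IsSClosureOperator P S C → ∀ a f h → S f h → C (h a) ≤ h (C a)
    S-closure⇒C∘h≤h∘C sc a f h s =
      trans (monotone _ _ (h-monotone (galois f h s) a (C a) (extensive a)))
            (IsSClosureOperator.S-closed sc a f h s)

    C∘h≤h∘C⇒S-closure : (∀ a f h → S f h → C (h a) ≤ h (C a)) → IsSClosureOperator P S C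
    C∘h≤h∘C⇒S-closure C∘h≤h∘C = record
      { extensive = extensive
      ; monotone  = monotone
      ; S-closed  = λ a f h s →
          trans (C∘h≤h∘C (C a) f h s)
                (h-monotone (galois f h s) _ _ (reflexive (idempotent a)))
      }

    S-closure⇔C∘h≤h∘C : IsSClosureOperator P S C ⇔ (∀ a f h → S f h → C (h a) ≤ h (C a))
    S-closure⇔C∘h≤h∘C = mk⇔ S-closure⇒C∘h≤h∘C C∘h≤h∘C⇒S-closure

    C∘h≤h∘C⇔f∘C≤C∘f : (∀ a f h → S f h → C (h a) ≤ h (C a))
                     ⇔ (∀ a f h → S f h → f (C a) ≤ C (f a))
    C∘h≤h∘C⇔f∘C≤C∘f = mk⇔
      (λ C∘h≤h∘C a f h s →
         C∘h≤h∘C⇒f∘C≤C∘f (galois f h s) monotone (λ b → C∘h≤h∘C b f h s) a)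
      (λ f∘C≤C∘f a f h s →
         f∘C≤C∘f⇒C∘h≤h∘C (galois f h s) monotone (λ b → f∘C≤C∘f b f h s) a)

theorem38 : ∀ {c ℓ₁ ℓ₂ ℓs ℓS : Level} (P : Poset c ℓ₁ ℓ₂)
    → IsCompleteLattice ℓs P
    → (S : Op P → Op P → Set ℓS) → IsParameterization P S
    → (C : Op P) → IsClosureOperator P C
    → let open Poset P in
    (IsSClosureOperator P S C ⇔ (∀ a f h → S f h → f (C a) ≤ C (f a)))
    × (IsSClosureOperator P S C ⇔ (∀ a f h → S f h → C (h a) ≤ h (C a)))
theorem38 P _ S par C cl =
  C∘h≤h∘C⇔f∘C≤C∘f ⇔-∘ S-closure⇔C∘h≤h∘C , S-closure⇔C∘h≤h∘C
  where open GaloisClosure.Closure P par cl
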